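{- Let $r\geq 3$ be odd. If $G$ is an $r$-regular graph on $n$ vertices, then \[\bar{\kappa}_{\max}(G)\le \frac{r-1}{2}+\frac{n}{4(n-1)}.\]
   Context: All graphs are finite, loopless, without multiple edges. An orientation of a graph $G$ is a digraph obtained by assigning a direction to every edge of $G$. For a digraph $D$ and distinct vertices $u,v$, $\kappa_D(u,v)$ is the maximum number of internally disjoint directed $u$--$v$ paths in $D$. The average connectivity of a digraph $D$ of order $n$ is $\bar{\kappa}(D)=\frac{1}{n(n-1)}\sum_{(u,v)}\kappa_D(u,v)$, summed over all ordered pairs of distinct vertices. For a graph $G$, $\bar{\kappa}_{\max}(G)$ is the maximum of $\bar{\kappa}(D)$ over all orientations $D$ of $G$. -}

module Defs where

open import Data.Bool using (Bool; true; false; T; _∨_; if_then_else_)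
open import Data.Nat using (ℕ; zero; suc; _+_; _*_; _∸_; _≤_)
open import Data.Fin using (Fin; _≟_)
open import Data.List using (List; []; _∷_; _++_; [_]; length; map; allFin)
open import Data.Nat.ListAction using (sum)
open import Data.Unit using (⊤)
open import Data.List.Membership.Propositional using (_∈_)
open import Data.List.Relation.Unary.AllPairs using (AllPairs)
open import Data.List.Relation.Unary.All using (All)
open import Data.List.Relation.Unary.Unique.Propositional using (Unique)
open import Data.Product using (_×_; Σ; ∃)
open import Data.Empty using (⊥)
open import Data.Integer using (+_)
open import Data.Rational using (ℚ; 0ℚ; _/_)
open import Relation.Nullary using (¬_; does)
open import Relation.Binary.PropositionalEquality using (_≡_; _≢_)

Graph : ℕ → Set
Graph n = Fin n → Fin n → Bool

IsSimpleGraph : {n : ℕ} → Graph n → Set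
IsSimpleGraph {n} G = (∀ u → G u u ≡ false) × (∀ u v → G u v ≡ G v u)

degree : {n : ℕ} → Graph n → Fin n → ℕ
degree {n} G u = sum (map (λ v → if G u v then 1 else 0) (allFin n))

Regular : {n : ℕ} → ℕ → Graph n → Set
Regular {n} r G = ∀ u → degree G u ≡ r

Digraph : ℕ → Set
Digraph n = Fin n → Fin n → Bool

IsOrientation : {n : ℕ} → Graph n → Digraph n → Set
IsOrientation {n} G D =
  (∀ u v → (D u v ∨ D v u) ≡ G u v) × (∀ u v → ¬ (T (D u v) × T (D v u)))

Arcs : {n : ℕ} → Digraph n → List (Fin n) → Set
Arcs D [] = ⊤
Arcs D (x ∷ []) = ⊤
Arcs D (x ∷ y ∷ rest) = T (D x y) × Arcs D (y ∷ rest)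

-- A directed u–v path in D, represented by its list of internal vertices ws:
-- the vertex sequence u, ws, v has no repeated vertices and each
-- consecutive pair is an arc of D.
IsPath : {n : ℕ} → Digraph n → Fin n → Fin n → List (Fin n) → Set
IsPath D u v ws = Unique (u ∷ ws ++ [ v ]) × Arcs D (u ∷ ws ++ [ v ])

Disjoint : {n : ℕ} → List (Fin n) → List (Fin n) → Set
Disjoint p q = ∀ x → x ∈ p → x ∈ q → ⊥

IsDisjointPathFamily : {n : ℕ} → Digraph n → Fin n → Fin n → List (List (Fin n)) → Set
IsDisjointPathFamily D u v ps =
  All (IsPath D u v) ps × AllPairs (λ p q → (p ≢ q) × Disjoint p q) ps

IsKappa : {n : ℕ} → Digraph n → Fin n → Fin n → ℕ → Set
IsKappa D u v k =
  Σ _ (λ ps → IsDisjointPathFamily D u v ps × length ps ≡ k)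
  × (∀ ps → IsDisjointPathFamily D u v ps → length ps ≤ k)

sumPairs : {n : ℕ} → (Fin n → Fin n → ℕ) → ℕ
sumPairs {n} k =
  sum (map (λ u → sum (map (λ v → if does (u ≟ v) then 0 else k u v) (allFin n))) (allFin n))

-- a / d as a rational number (convention: a / 0 = 0; never used with d = 0
-- for the nonempty graphs of the theorem)
frac : ℕ → ℕ → ℚ
frac a zero = 0ℚ
frac a (suc d) = (+ a) / suc d

avgConn : (n : ℕ) → (Fin n → Fin n → ℕ) → ℚ
avgConn n k = frac (sumPairs k) (n * (n ∸ 1))

-- Write r = 2h + 1.  Internally disjoint u–v paths leave u through distinct
-- arcs and enter v through distinct arcs, so κ(u,v) is at most the out-degree
-- of u and the in-degree of v.  Since out-degree plus in-degree is 2h + 1, every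
-- vertex has out-degree ≤ h ("out-small") or else in-degree ≤ h.  Hence
-- κ(u,v) + κ(v,u) ≤ 2h for every pair except those with exactly one out-small
-- vertex, where it is still ≤ 2h + 1.  If a vertices are out-small and b are
-- not, the sum of κ over ordered pairs is at most n(n−1)h + ab ≤ n(n−1)h + n²/4.
module Submission where

open import Data.Bool using (Bool; true; false; T; not; if_then_else_)
open import Data.Empty using (⊥-elim)
open import Data.Fin using (Fin; _≟_) renaming (zero to fzero; suc to fsuc)
open import Data.Integer as ℤ using (+≤+)
import Data.Integer.Properties as ℤₚ
open import Data.List using (List; []; _∷_; _++_; [_]; length; map; allFin; tabulate)
open import Data.List.Membership.Propositional using (_∈_; _∉_)
open import Data.List.Membership.Propositional.Properties using (∈-++⁺ˡ; ∈-++⁺ʳ)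
open import Data.List.Properties using (map-tabulate; length-map)
open import Data.List.Relation.Unary.All as All using (All; []; _∷_)
import Data.List.Relation.Unary.All.Properties as Allₚ
open import Data.List.Relation.Unary.AllPairs using (AllPairs; []; _∷_)
open import Data.List.Relation.Unary.Any using (here; there)
open import Data.List.Relation.Unary.Unique.Propositional using (Unique)
open import Data.Nat using (ℕ; zero; suc; _+_; _*_; _∸_; _≤_; _≤ᵇ_; z≤n)
open import Data.Nat.Divisibility using (_∣_; _∣0; ∣-refl; ∣m∣n⇒∣m+n)
open import Data.Nat.ListAction using (sum)
open import Data.Nat.Properties hiding (_≟_)
open import Algebra.Properties.CommutativeSemigroup +-commutativeSemigroup using (interchange)
open import Data.Nat.Tactic.RingSolver using (solve-∀)
open import Data.Product using (Σ; _×_; _,_; proj₂)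
open import Data.Rational using (toℚᵘ) renaming (_+_ to _+ℚ_; _≤_ to _≤ℚ_)
import Data.Rational.Properties as ℚₚ
open import Data.Rational.Unnormalised as ℚᵘ using (mkℚᵘ; *≤*)
import Data.Rational.Unnormalised.Properties as ℚᵘₚ
open import Data.Sum using (inj₁; inj₂)
open import Data.Unit using (tt)
open import Function using (_∘_)
open import Relation.Binary.PropositionalEquality
  using (_≡_; _≢_; refl; sym; trans; cong; cong₂; subst; subst₂; module ≡-Reasoning)
open import Relation.Nullary using (¬_; does; yes; no)
open import Relation.Nullary.Reflects using (ofʸ; ofⁿ)

open import Defs

χ : Bool → ℕ
χ b = if b then 1 else 0

∑ : {n : ℕ} → (Fin n → ℕ) → ℕ
∑ f = sum (tabulate f)

∑₂ : {n : ℕ} → (Fin n → Fin n → ℕ) → ℕ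
∑₂ F = ∑ λ u → ∑ λ v → F u v

count : {n : ℕ} → (Fin n → Bool) → ℕ
count p = ∑ (χ ∘ p)

∑-allFin : ∀ {n} (f : Fin n → ℕ) → sum (map f (allFin n)) ≡ ∑ f
∑-allFin {n} f = cong sum (map-tabulate (λ i → i) f)

∑-cong : ∀ {n} {f g : Fin n → ℕ} → (∀ i → f i ≡ g i) → ∑ f ≡ ∑ g
∑-cong {zero}  f≗g = refl
∑-cong {suc n} f≗g = cong₂ _+_ (f≗g fzero) (∑-cong (f≗g ∘ fsuc))

∑-mono-≤ : ∀ {n} {f g : Fin n → ℕ} → (∀ i → f i ≤ g i) → ∑ f ≤ ∑ g
∑-mono-≤ {zero}  f≤g = z≤n
∑-mono-≤ {suc n} f≤g = +-mono-≤ (f≤g fzero) (∑-mono-≤ (f≤g ∘ fsuc))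

∑-distrib-+ : ∀ {n} (f g : Fin n → ℕ) → ∑ (λ i → f i + g i) ≡ ∑ f + ∑ g
∑-distrib-+ {zero}  f g = refl
∑-distrib-+ {suc n} f g =
  trans (cong (f fzero + g fzero +_) (∑-distrib-+ (f ∘ fsuc) (g ∘ fsuc)))
        (interchange (f fzero) (g fzero) (∑ (f ∘ fsuc)) (∑ (g ∘ fsuc)))

∑₂-distrib-+ : ∀ {n} (F H : Fin n → Fin n → ℕ) → ∑₂ (λ u v → F u v + H u v) ≡ ∑₂ F + ∑₂ H
∑₂-distrib-+ F H =
  trans (∑-cong (λ u → ∑-distrib-+ (F u) (H u))) (∑-distrib-+ (λ u → ∑ (F u)) (λ u → ∑ (H u)))

∑-const : ∀ n c → ∑ {n} (λ _ → c) ≡ n * c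
∑-const zero    c = refl
∑-const (suc n) c = cong (c +_) (∑-const n c)

∑-*ʳ : ∀ {n} (f : Fin n → ℕ) c → ∑ (λ i → f i * c) ≡ ∑ f * c
∑-*ʳ {zero}  f c = refl
∑-*ʳ {suc n} f c =
  trans (cong (f fzero * c +_) (∑-*ʳ (f ∘ fsuc) c)) (sym (*-distribʳ-+ c (f fzero) _))

∑₂-product : ∀ {n} (f g : Fin n → ℕ) → ∑₂ (λ u v → f u * g v) ≡ ∑ f * ∑ g
∑₂-product f g = begin
  ∑ (λ u → ∑ λ v → f u * g v)  ≡⟨ ∑-cong (λ u → ∑-cong (λ v → *-comm (f u) (g v))) ⟩
  ∑ (λ u → ∑ λ v → g v * f u)  ≡⟨ ∑-cong (λ u → ∑-*ʳ g (f u)) ⟩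
  ∑ (λ u → ∑ g * f u)          ≡⟨ ∑-cong (λ u → *-comm (∑ g) (f u)) ⟩
  ∑ (λ u → f u * ∑ g)          ≡⟨ ∑-*ʳ f (∑ g) ⟩
  ∑ f * ∑ g                    ∎
  where open ≡-Reasoning

∑-comm : ∀ {m n} (F : Fin m → Fin n → ℕ) → ∑ (λ i → ∑ (F i)) ≡ ∑ (λ j → ∑ λ i → F i j)
∑-comm {zero}  {n} F = sym (trans (∑-const n 0) (*-zeroʳ n))
∑-comm {suc m}     F =
  trans (cong (∑ (F fzero) +_) (∑-comm (F ∘ fsuc)))
        (sym (∑-distrib-+ (F fzero) (λ j → ∑ λ i → F (fsuc i) j)))

count-≟ : ∀ {n} (u : Fin n) → count (λ v → does (u ≟ v)) ≡ 1
count-≟ {suc n} fzero    = cong suc (trans (∑-const n 0) (*-zeroʳ n))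
count-≟ {suc n} (fsuc u) = count-≟ u

multiplicity : ∀ {n} → List (Fin n) → Fin n → ℕ
multiplicity xs v = sum (map (λ x → χ (does (x ≟ v))) xs)

∑-multiplicity : ∀ {n} (xs : List (Fin n)) → ∑ (multiplicity xs) ≡ length xs
∑-multiplicity {n} [] = trans (∑-const n 0) (*-zeroʳ n)
∑-multiplicity (x ∷ xs) =
  trans (∑-distrib-+ _ (multiplicity xs)) (cong₂ _+_ (count-≟ x) (∑-multiplicity xs))

multiplicity-∉ : ∀ {n} {v : Fin n} {xs} → v ∉ xs → multiplicity xs v ≡ 0
multiplicity-∉ {xs = []}     v∉xs = refl
multiplicity-∉ {v = v} {x ∷ xs} v∉xs with x ≟ v
... | yes refl = ⊥-elim (v∉xs (here refl))
... | no _     = multiplicity-∉ (v∉xs ∘ there)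

multiplicity-unique : ∀ {n} {v : Fin n} {xs} → Unique xs → multiplicity xs v ≤ 1
multiplicity-unique {xs = []}     []               = z≤n
multiplicity-unique {v = v} {x ∷ xs} (x∉xs ∷ xs-uniq) with x ≟ v
... | yes refl = ≤-reflexive (cong suc (multiplicity-∉ (Allₚ.All¬⇒¬Any x∉xs)))
... | no _     = multiplicity-unique xs-uniq

length≤count : ∀ {n} (p : Fin n → Bool) {xs} → Unique xs → All (T ∘ p) xs → length xs ≤ count p
length≤count p {xs} xs-uniq all-p = subst (_≤ count p) (∑-multiplicity xs) (∑-mono-≤ bound)
  where
  bound : ∀ v → multiplicity xs v ≤ χ (p v)
  bound v with p v in pv
  ... | true  = multiplicity-unique xs-uniq
  ... | false = ≤-reflexive (multiplicity-∉ (λ v∈xs → subst T pv (All.lookup all-p v∈xs)))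

-- On a path s, p, t with interior p, firstOr t p is the successor of s and
-- lastOr s p the predecessor of t.
firstOr : ∀ {n} → Fin n → List (Fin n) → Fin n
firstOr d []      = d
firstOr d (x ∷ _) = x

lastOr : ∀ {n} → Fin n → List (Fin n) → Fin n
lastOr d []       = d
lastOr d (x ∷ xs) = lastOr x xs

ChoosesFrom : ∀ {n} → Fin n → (List (Fin n) → Fin n) → Set
ChoosesFrom d f = f [] ≡ d × (∀ x xs → f (x ∷ xs) ∈ x ∷ xs)

firstOr-chooses : ∀ {n} (d : Fin n) → ChoosesFrom d (firstOr d)
firstOr-chooses d = refl , λ _ _ → here refl

lastOr-chooses : ∀ {n} (d : Fin n) → ChoosesFrom d (lastOr d)
lastOr-chooses d = refl , lastOr-∈
  where
  lastOr-∈ : ∀ x xs → lastOr x xs ∈ x ∷ xs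
  lastOr-∈ x []       = here refl
  lastOr-∈ x (y ∷ ys) = there (lastOr-∈ y ys)

choice-injective : ∀ {n} {d : Fin n} {f p q} → ChoosesFrom d f →
  p ≢ q → Disjoint p q → d ∉ p → d ∉ q → f p ≢ f q
choice-injective {p = []}    {q = []}    _ p≢q _ _ _ _ = p≢q refl
choice-injective {p = []}    {q = y ∷ q} (f[]≡d , f∈) _ _ _ d∉q fp≡fq =
  d∉q (subst (_∈ y ∷ q) (trans (sym fp≡fq) f[]≡d) (f∈ y q))
choice-injective {p = x ∷ p} {q = []}    (f[]≡d , f∈) _ _ d∉p _ fp≡fq =
  d∉p (subst (_∈ x ∷ p) (trans fp≡fq f[]≡d) (f∈ x p))
choice-injective {p = x ∷ p} {q = y ∷ q} (_ , f∈) _ disjoint _ _ fp≡fq =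
  disjoint _ (f∈ x p) (subst (_∈ y ∷ q) (sym fp≡fq) (f∈ y q))

choices-unique : ∀ {n} {d : Fin n} {f ps} → ChoosesFrom d f → All (d ∉_) ps →
  AllPairs (λ p q → p ≢ q × Disjoint p q) ps → Unique (map f ps)
choices-unique ch []             []                    = []
choices-unique ch (d∉p ∷ d∉ps) (p-apart ∷ ps-apart) =
  Allₚ.map⁺ (All.zipWith (λ (d∉q , p≢q , disjoint) → choice-injective ch p≢q disjoint d∉p d∉q)
                        (d∉ps , p-apart))
  ∷ choices-unique ch d∉ps ps-apart

outdeg : ∀ {n} → Digraph n → Fin n → ℕ
outdeg D u = count (D u)

indeg : ∀ {n} → Digraph n → Fin n → ℕ
indeg D v = count (λ w → D w v)

last-arc : ∀ {n} {D : Digraph n} {t} s p → Arcs D (s ∷ p ++ [ t ]) → T (D (lastOr s p) t)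
last-arc s []      (s→t , _)  = s→t
last-arc s (x ∷ p) (_ , arcs) = last-arc x p arcs

module _ {n : ℕ} {D : Digraph n} {s t : Fin n} where

  first-arc : ∀ p → Arcs D (s ∷ p ++ [ t ]) → T (D s (firstOr t p))
  first-arc []      (s→t , _) = s→t
  first-arc (x ∷ p) (s→x , _) = s→x

  source∉interior : ∀ {p} → IsPath D s t p → s ∉ p
  source∉interior ((s∉ ∷ _) , _) s∈p = All.lookup s∉ (∈-++⁺ˡ s∈p) refl

  target∉interior : ∀ {p} → IsPath D s t p → t ∉ p
  target∉interior ((_ ∷ uniq) , _) = t∉init uniq
    where
    t∉init : ∀ {xs} → Unique (xs ++ [ t ]) → t ∉ xs
    t∉init {x ∷ xs} (x∉ ∷ _) (here refl) = All.lookup x∉ (∈-++⁺ʳ xs (here refl)) refl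
    t∉init {x ∷ xs} (_ ∷ uniq) (there t∈xs) = t∉init uniq t∈xs

  family-size≤outdeg : ∀ {ps} → IsDisjointPathFamily D s t ps → length ps ≤ outdeg D s
  family-size≤outdeg {ps} (paths , apart) = subst (_≤ outdeg D s) (length-map (firstOr t) ps)
    (length≤count (D s)
      (choices-unique (firstOr-chooses t) (All.map target∉interior paths) apart)
      (Allₚ.map⁺ (All.map (λ {p} → first-arc p ∘ proj₂) paths)))

  family-size≤indeg : ∀ {ps} → IsDisjointPathFamily D s t ps → length ps ≤ indeg D t
  family-size≤indeg {ps} (paths , apart) = subst (_≤ indeg D t) (length-map (lastOr s) ps)
    (length≤count (λ w → D w t)
      (choices-unique (lastOr-chooses s) (All.map source∉interior paths) apart)
      (Allₚ.map⁺ (All.map (λ {p} → last-arc s p ∘ proj₂) paths)))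

  κ≤outdeg : ∀ {k} → IsKappa D s t k → k ≤ outdeg D s
  κ≤outdeg ((_ , family , refl) , _) = family-size≤outdeg family

  κ≤indeg : ∀ {k} → IsKappa D s t k → k ≤ indeg D t
  κ≤indeg ((_ , family , refl) , _) = family-size≤indeg family

outdeg+indeg≡degree : ∀ {n} {G : Graph n} {D : Digraph n} → IsOrientation G D →
  ∀ u → outdeg D u + indeg D u ≡ degree G u
outdeg+indeg≡degree {G = G} {D} (oriented , antisymmetric) u =
  trans (sym (∑-distrib-+ (χ ∘ D u) (λ w → χ (D w u))))
        (trans (∑-cong arcs≡edge) (sym (∑-allFin (χ ∘ G u))))
  where
  arcs≡edge : ∀ w → χ (D u w) + χ (D w u) ≡ χ (G u w)
  arcs≡edge w rewrite sym (oriented u w) with D u w | D w u | antisymmetric u w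
  ... | true  | true  | ¬both = ⊥-elim (¬both (tt , tt))
  ... | true  | false | _     = refl
  ... | false | true  | _     = refl
  ... | false | false | _     = refl

offDiagonal : ∀ {n} → (Fin n → Fin n → ℕ) → Fin n → Fin n → ℕ
offDiagonal F u v = if does (u ≟ v) then 0 else F u v

sumPairs≡∑₂-offDiagonal : ∀ {n} (F : Fin n → Fin n → ℕ) → sumPairs F ≡ ∑₂ (offDiagonal F)
sumPairs≡∑₂-offDiagonal {n} F =
  trans (∑-allFin (λ u → sum (map (offDiagonal F u) (allFin n))))
        (∑-cong (λ u → ∑-allFin (offDiagonal F u)))

offDiagonal-pair : ∀ {n} {F G : Fin n → Fin n → ℕ} →
  (∀ u v → u ≢ v → F u v + F v u ≤ G u v + G v u) →
  ∀ u v → offDiagonal F u v + offDiagonal F v u ≤ offDiagonal G u v + offDiagonal G v u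
offDiagonal-pair pair≤ u v with u ≟ v | v ≟ u
... | yes _   | yes _   = z≤n
... | yes u≡v | no  v≢u = ⊥-elim (v≢u (sym u≡v))
... | no  u≢v | yes v≡u = ⊥-elim (u≢v (sym v≡u))
... | no  u≢v | no  _   = pair≤ u v u≢v

offDiagonal-+ : ∀ {n} (F H : Fin n → Fin n → ℕ) u v →
  offDiagonal (λ u v → F u v + H u v) u v ≤ F u v + offDiagonal H u v
offDiagonal-+ F H u v with does (u ≟ v)
... | true  = z≤n
... | false = ≤-refl

∑-offDiagonal-const : ∀ {n} c (u : Fin n) → ∑ (offDiagonal (λ _ _ → c) u) ≡ (n ∸ 1) * c
∑-offDiagonal-const {suc n}       c fzero    = ∑-const n c
∑-offDiagonal-const {suc (suc n)} c (fsuc u) = cong (c +_) (∑-offDiagonal-const c u)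

∑₂-offDiagonal-const : ∀ {n} c → ∑₂ {n} (offDiagonal (λ _ _ → c)) ≡ n * ((n ∸ 1) * c)
∑₂-offDiagonal-const {n} c = trans (∑-cong (∑-offDiagonal-const {n} c)) (∑-const n ((n ∸ 1) * c))

∑₂-symmetrise : ∀ {n} (F : Fin n → Fin n → ℕ) → ∑₂ F + ∑₂ F ≡ ∑₂ (λ u v → F u v + F v u)
∑₂-symmetrise F = begin
  ∑₂ F + ∑₂ F                                     ≡⟨ cong (∑₂ F +_) (∑-comm F) ⟩
  ∑₂ F + ∑₂ (λ u v → F v u)                       ≡⟨ ∑-distrib-+ (λ u → ∑ (F u)) _ ⟨
  ∑ (λ u → ∑ (F u) + ∑ (λ v → F v u))             ≡⟨ ∑-cong (λ u → ∑-distrib-+ (F u) (λ v → F v u)) ⟨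
  ∑₂ (λ u v → F u v + F v u)                      ∎
  where open ≡-Reasoning

∑₂-mono-symmetric : ∀ {n} {F G : Fin n → Fin n → ℕ} →
  (∀ u v → F u v + F v u ≤ G u v + G v u) → ∑₂ F ≤ ∑₂ G
∑₂-mono-symmetric {F = F} {G} pair≤ = *-cancelˡ-≤ 2 (begin
  2 * ∑₂ F                      ≡⟨ double (∑₂ F) ⟩
  ∑₂ F + ∑₂ F                   ≡⟨ ∑₂-symmetrise F ⟩
  ∑₂ (λ u v → F u v + F v u)    ≤⟨ ∑-mono-≤ (λ u → ∑-mono-≤ (pair≤ u)) ⟩
  ∑₂ (λ u v → G u v + G v u)    ≡⟨ ∑₂-symmetrise G ⟨
  ∑₂ G + ∑₂ G                   ≡⟨ double (∑₂ G) ⟨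
  2 * ∑₂ G                      ∎)
  where
  open ≤-Reasoning
  double : ∀ m → 2 * m ≡ m + m
  double m = cong (m +_) (+-identityʳ m)

am-gm-≤ : ∀ {m n} → m ≤ n → 4 * (m * n) ≤ (m + n) * (m + n)
am-gm-≤ {m} {n} m≤n =
  subst (λ n → 4 * (m * n) ≤ (m + n) * (m + n)) (m+[n∸m]≡n m≤n) (with-gap (n ∸ m))
  where
  square-split : ∀ m k → (m + (m + k)) * (m + (m + k)) ≡ 4 * (m * (m + k)) + k * k
  square-split = solve-∀
  with-gap : ∀ k → 4 * (m * (m + k)) ≤ (m + (m + k)) * (m + (m + k))
  with-gap k = subst (4 * (m * (m + k)) ≤_) (sym (square-split m k)) (m≤m+n _ (k * k))

am-gm : ∀ m n → 4 * (m * n) ≤ (m + n) * (m + n)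
am-gm m n with ≤-total m n
... | inj₁ m≤n = am-gm-≤ m≤n
... | inj₂ n≤m = subst₂ _≤_ (cong (4 *_) (*-comm n m)) (cong (λ s → s * s) (+-comm n m)) (am-gm-≤ n≤m)

count-not+count : ∀ {n} (p : Fin n → Bool) → count (not ∘ p) + count p ≡ n
count-not+count {n} p = begin
  count (not ∘ p) + count p          ≡⟨ ∑-distrib-+ (χ ∘ not ∘ p) (χ ∘ p) ⟨
  ∑ (λ v → χ (not (p v)) + χ (p v))  ≡⟨ ∑-cong (λ v → χ-not+χ (p v)) ⟩
  ∑ {n} (λ _ → 1)                    ≡⟨ ∑-const n 1 ⟩
  n * 1                              ≡⟨ *-identityʳ n ⟩
  n                                  ∎
  where
  open ≡-Reasoning
  χ-not+χ : ∀ b → χ (not b) + χ b ≡ 1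
  χ-not+χ true  = refl
  χ-not+χ false = refl

crossing-pairs-bound : ∀ {n} (p : Fin n → Bool) →
  4 * ∑₂ (λ u v → χ (not (p u)) * χ (p v)) ≤ n * n
crossing-pairs-bound {n} p = begin
  4 * ∑₂ (λ u v → χ (not (p u)) * χ (p v))
    ≡⟨ cong (4 *_) (∑₂-product (χ ∘ not ∘ p) (χ ∘ p)) ⟩
  4 * (count (not ∘ p) * count p)
    ≤⟨ am-gm (count (not ∘ p)) (count p) ⟩
  (count (not ∘ p) + count p) * (count (not ∘ p) + count p)
    ≡⟨ cong (λ m → m * m) (count-not+count p) ⟩
  n * n ∎
  where open ≤-Reasoning

suc[h*2]≡suc[h]+h : ∀ h → suc (h * 2) ≡ suc h + h
suc[h*2]≡suc[h]+h = solve-∀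

module OddDegreeCounting {n : ℕ} (d⁺ d⁻ : Fin n → ℕ) (h : ℕ)
  (degree-odd : ∀ u → d⁺ u + d⁻ u ≡ suc (h * 2))
  (κ : Fin n → Fin n → ℕ)
  (κ≤d⁺ : ∀ u v → u ≢ v → κ u v ≤ d⁺ u)
  (κ≤d⁻ : ∀ u v → u ≢ v → κ u v ≤ d⁻ v) where

  open ≤-Reasoning

  outSmall : Fin n → Bool
  outSmall u = d⁺ u ≤ᵇ h

  d⁻≤h : ∀ {u} → ¬ d⁺ u ≤ h → d⁻ u ≤ h
  d⁻≤h {u} d⁺≰h = +-cancelˡ-≤ (suc h) (d⁻ u) h (begin
    suc h + d⁻ u  ≤⟨ +-monoˡ-≤ (d⁻ u) (≰⇒> d⁺≰h) ⟩
    d⁺ u + d⁻ u   ≡⟨ degree-odd u ⟩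
    suc (h * 2)   ≡⟨ suc[h*2]≡suc[h]+h h ⟩
    suc h + h     ∎)

  crossing : Fin n → Fin n → ℕ
  crossing u v = χ (not (outSmall u)) * χ (outSmall v)

  uniform : Fin n → Fin n → ℕ
  uniform _ _ = h

  -- With crossing first, bound reduces to h or 1 + h as soon as the two
  -- comparisons d⁺ _ ≤ᵇ h are evaluated, which the case split below relies on.
  bound : Fin n → Fin n → ℕ
  bound u v = crossing u v + uniform u v

  κ-pair≤bound : ∀ u v → u ≢ v → κ u v + κ v u ≤ bound u v + bound v u
  κ-pair≤bound u v u≢v
    with d⁺ u ≤ᵇ h | ≤ᵇ-reflects-≤ (d⁺ u) h | d⁺ v ≤ᵇ h | ≤ᵇ-reflects-≤ (d⁺ v) h
  ... | true  | ofʸ d⁺u≤h | true  | ofʸ d⁺v≤h =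
    +-mono-≤ (≤-trans (κ≤d⁺ u v u≢v) d⁺u≤h) (≤-trans (κ≤d⁺ v u (u≢v ∘ sym)) d⁺v≤h)
  ... | false | ofⁿ d⁺u≰h | false | ofⁿ d⁺v≰h =
    +-mono-≤ (≤-trans (κ≤d⁻ u v u≢v) (d⁻≤h d⁺v≰h)) (≤-trans (κ≤d⁻ v u (u≢v ∘ sym)) (d⁻≤h d⁺u≰h))
  ... | false | _         | true  | _         = begin
    κ u v + κ v u  ≤⟨ +-mono-≤ (κ≤d⁺ u v u≢v) (κ≤d⁻ v u (u≢v ∘ sym)) ⟩
    d⁺ u + d⁻ u    ≡⟨ degree-odd u ⟩
    suc (h * 2)    ≡⟨ suc[h*2]≡suc[h]+h h ⟩
    suc h + h      ∎
  ... | true  | _         | false | _         = begin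
    κ u v + κ v u  ≤⟨ +-mono-≤ (κ≤d⁻ u v u≢v) (κ≤d⁺ v u (u≢v ∘ sym)) ⟩
    d⁻ v + d⁺ v    ≡⟨ +-comm (d⁻ v) (d⁺ v) ⟩
    d⁺ v + d⁻ v    ≡⟨ degree-odd v ⟩
    suc (h * 2)    ≡⟨ suc[h*2]≡suc[h]+h h ⟩
    suc h + h      ≡⟨ +-comm (suc h) h ⟩
    h + suc h      ∎

  sumPairs-bound : 4 * sumPairs κ ≤ n * n + 4 * (n * ((n ∸ 1) * h))
  sumPairs-bound = begin
    4 * sumPairs κ
      ≡⟨ cong (4 *_) (sumPairs≡∑₂-offDiagonal κ) ⟩
    4 * ∑₂ (offDiagonal κ)
      ≤⟨ *-monoʳ-≤ 4 (∑₂-mono-symmetric (offDiagonal-pair κ-pair≤bound)) ⟩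
    4 * ∑₂ (offDiagonal bound)
      ≤⟨ *-monoʳ-≤ 4 (∑-mono-≤ λ u → ∑-mono-≤ (offDiagonal-+ crossing uniform u)) ⟩
    4 * ∑₂ (λ u v → crossing u v + offDiagonal uniform u v)
      ≡⟨ cong (4 *_) (∑₂-distrib-+ crossing (offDiagonal uniform)) ⟩
    4 * (∑₂ crossing + ∑₂ (offDiagonal uniform))
      ≡⟨ *-distribˡ-+ 4 (∑₂ crossing) _ ⟩
    4 * ∑₂ crossing + 4 * ∑₂ (offDiagonal uniform)
      ≤⟨ +-mono-≤ (crossing-pairs-bound outSmall)
                  (≤-reflexive (cong (4 *_) (∑₂-offDiagonal-const {n} h))) ⟩
    n * n + 4 * (n * ((n ∸ 1) * h)) ∎

frac-suc≃ : ∀ a d → toℚᵘ (frac a (suc d)) ℚᵘ.≃ mkℚᵘ (ℤ.+ a) d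
frac-suc≃ a d = ℚₚ.toℚᵘ-fromℚᵘ (mkℚᵘ (ℤ.+ a) d)

mkℚᵘ-≤-+ : ∀ a b c d₁ d₂ d₃ →
  a * (suc d₂ * suc d₃) ≤ (b * suc d₃ + c * suc d₂) * suc d₁ →
  mkℚᵘ (ℤ.+ a) d₁ ℚᵘ.≤ mkℚᵘ (ℤ.+ b) d₂ ℚᵘ.+ mkℚᵘ (ℤ.+ c) d₃
mkℚᵘ-≤-+ a b c d₁ d₂ d₃ cross = *≤* (subst₂ ℤ._≤_ (ℤₚ.pos-* a _) numerators (+≤+ cross))
  where
  numerators : ℤ.+ ((b * suc d₃ + c * suc d₂) * suc d₁)
             ≡ (ℤ.+ b ℤ.* ℤ.+ suc d₃ ℤ.+ ℤ.+ c ℤ.* ℤ.+ suc d₂) ℤ.* ℤ.+ suc d₁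
  numerators = begin
    ℤ.+ ((b * suc d₃ + c * suc d₂) * suc d₁)
      ≡⟨ ℤₚ.pos-* (b * suc d₃ + c * suc d₂) (suc d₁) ⟩
    ℤ.+ (b * suc d₃ + c * suc d₂) ℤ.* ℤ.+ suc d₁
      ≡⟨ cong (ℤ._* ℤ.+ suc d₁) (ℤₚ.pos-+ (b * suc d₃) (c * suc d₂)) ⟩
    (ℤ.+ (b * suc d₃) ℤ.+ ℤ.+ (c * suc d₂)) ℤ.* ℤ.+ suc d₁
      ≡⟨ cong (ℤ._* ℤ.+ suc d₁) (cong₂ ℤ._+_ (ℤₚ.pos-* b (suc d₃)) (ℤₚ.pos-* c (suc d₂))) ⟩
    (ℤ.+ b ℤ.* ℤ.+ suc d₃ ℤ.+ ℤ.+ c ℤ.* ℤ.+ suc d₂) ℤ.* ℤ.+ suc d₁ ∎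
    where open ≡-Reasoning

frac-≤-+ : ∀ a b c d₁ d₂ d₃ →
  a * (suc d₂ * suc d₃) ≤ (b * suc d₃ + c * suc d₂) * suc d₁ →
  frac a (suc d₁) ≤ℚ frac b (suc d₂) +ℚ frac c (suc d₃)
frac-≤-+ a b c d₁ d₂ d₃ cross = ℚₚ.toℚᵘ-cancel-≤
  (ℚᵘₚ.≤-respˡ-≃ (ℚᵘₚ.≃-sym (frac-suc≃ a d₁))
    (ℚᵘₚ.≤-respʳ-≃ (ℚᵘₚ.≃-sym (ℚᵘₚ.≃-trans (ℚₚ.toℚᵘ-homo-+ (frac b (suc d₂)) (frac c (suc d₃)))
                                             (ℚᵘₚ.+-cong (frac-suc≃ b d₂) (frac-suc≃ c d₃))))
      (mkℚᵘ-≤-+ a b c d₁ d₂ d₃ cross)))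

average-bound : ∀ n h S → 4 * S ≤ n * n + 4 * (n * ((n ∸ 1) * h)) →
  frac S (n * (n ∸ 1)) ≤ℚ frac (h * 2) 2 +ℚ frac n (4 * (n ∸ 1))
-- For n ≤ 1 both sides are 0 because frac a 0 = 0.
average-bound 0 h S _ = frac-≤-+ 0 (h * 2) 0 0 1 0 z≤n
average-bound 1 h S _ = frac-≤-+ 0 (h * 2) 0 0 1 0 z≤n
average-bound n@(suc k@(suc _)) h S 4S≤ = frac-≤-+ S (h * 2) n _ 1 _ (begin
  S * (2 * (4 * k))                          ≡⟨ regroup S k ⟩
  4 * S * (2 * k)                            ≤⟨ *-monoˡ-≤ (2 * k) 4S≤ ⟩
  (n * n + 4 * (n * (k * h))) * (2 * k)      ≡⟨ cross-multiplied n k h ⟩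
  (h * 2 * (4 * k) + n * 2) * (n * k)        ∎)
  where
  open ≤-Reasoning
  regroup : ∀ S k → S * (2 * (4 * k)) ≡ 4 * S * (2 * k)
  regroup = solve-∀
  cross-multiplied : ∀ n k h → (n * n + 4 * (n * (k * h))) * (2 * k) ≡ (h * 2 * (4 * k) + n * 2) * (n * k)
  cross-multiplied = solve-∀

odd-half : ∀ r → ¬ (2 ∣ r) → Σ ℕ λ h → r ≡ suc (h * 2)
odd-half 0             2∤r = ⊥-elim (2∤r (2 ∣0))
odd-half 1             _   = 0 , refl
odd-half (suc (suc r)) 2∤r with odd-half r (2∤r ∘ ∣m∣n⇒∣m+n ∣-refl)
... | h , refl = suc h , refl

theorem3p2 : (r : ℕ) → 3 ≤ r → ¬ (2 ∣ r) →
    (n : ℕ) → (G : Graph n) → IsSimpleGraph G → Regular r G →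
    (D : Digraph n) → IsOrientation G D →
    (κ : Fin n → Fin n → ℕ) → (∀ u v → u ≢ v → IsKappa D u v (κ u v)) →
    avgConn n κ ≤ℚ (frac (r ∸ 1) 2 +ℚ frac n (4 * (n ∸ 1)))
theorem3p2 r _ 2∤r n G _ regular D orientation κ κ-spec with odd-half r 2∤r
... | h , refl = average-bound n h (sumPairs κ) sumPairs-bound
  where
  open OddDegreeCounting (outdeg D) (indeg D) h
    (λ u → trans (outdeg+indeg≡degree orientation u) (regular u))
    κ (λ u v u≢v → κ≤outdeg (κ-spec u v u≢v)) (λ u v u≢v → κ≤indeg (κ-spec u v u≢v))
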